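{- For all integers $1 \le t \le r$ we have \[ R(r,t) \ge \left\lfloor \frac{r-t}{2} \right\rfloor + 1. \]
   Context: All hypergraphs are finite. An $r$-uniform hypergraph $\mathcal H$ is $r$-partite if its vertex set can be partitioned as $V(\mathcal H)=P_1\sqcup\dots\sqcup P_r$ such that $|e\cap P_j|=1$ for every edge $e$ and every $j\in[r]$. It is $t$-intersecting if $|e\cap f|\ge t$ for all $e,f\in E(\mathcal H)$. An $(r,t)$-graph is an $r$-uniform, $r$-partite, $t$-intersecting hypergraph. A cover of $\mathcal H$ is a set $C\subseteq V(\mathcal H)$ with $C\cap e\neq\emptyset$ for every edge $e$; the cover number $\tau(\mathcal H)$ is the minimum size of a cover. $R(r,t)$ denotes the maximum of $\tau(\mathcal H)$ over all $(r,t)$-graphs $\mathcal H$. -}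

module Defs where

open import Data.Nat using (ℕ; _≤_)
open import Data.Fin using (Fin)
open import Data.Fin.Subset using (Subset; _∈_; _∩_; ∣_∣)
open import Data.Fin.Properties using (_≟_)
open import Data.Vec using (tabulate)
open import Data.Product using (Σ; ∃; _×_)
open import Relation.Nullary.Decidable using (⌊_⌋)
open import Relation.Binary.PropositionalEquality using (_≡_)

record Hypergraph : Set where
  field
    nV   : ℕ
    nE   : ℕ
    edge : Fin nE → Subset nV
open Hypergraph public

IsUniform : ℕ → Hypergraph → Set
IsUniform r H = ∀ i → ∣ edge H i ∣ ≡ r

part : ∀ {n r} → (Fin n → Fin r) → Fin r → Subset n
part p j = tabulate (λ v → ⌊ p v ≟ j ⌋)

IsPartite : ℕ → Hypergraph → Set
IsPartite r H =
  Σ (Fin (nV H) → Fin r) λ p → ∀ i j → ∣ edge H i ∩ part p j ∣ ≡ 1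

IsIntersecting : ℕ → Hypergraph → Set
IsIntersecting t H = ∀ i j → t ≤ ∣ edge H i ∩ edge H j ∣

IsRTGraph : ℕ → ℕ → Hypergraph → Set
IsRTGraph r t H = IsUniform r H × IsPartite r H × IsIntersecting t H

IsCover : (H : Hypergraph) → Subset (nV H) → Set
IsCover H C = ∀ i → ∃ λ v → v ∈ C × v ∈ edge H i

CoverNumberAtLeast : Hypergraph → ℕ → Set
CoverNumberAtLeast H k = ∀ C → IsCover H C → k ≤ ∣ C ∣

RAtLeast : ℕ → ℕ → ℕ → Set
RAtLeast r t k = Σ Hypergraph λ H → IsRTGraph r t H × CoverNumberAtLeast H k

module Submission where

-- Put k = ⌊(r−t)/2⌋ and take the alphabet Fin (k+2), whose letter 0 is
-- called blank.  A word x of length n is identified with its trace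
-- {(i , x i) | i < n}, a subset of the grid Fin n × Fin q ≅ Fin (n*q), and
-- the hypergraph has as edges the traces of all words with at most k
-- non-blank letters ("light" words).  Every trace meets each row
-- {i} × Fin q in exactly one vertex, so the graph is r-uniform and
-- r-partite; two light words agree wherever both are blank, i.e. in at
-- least r − 2k ≥ t positions, so it is t-intersecting; and for any vertex
-- set C with |C| ≤ k one can choose, row by row, a light word whose trace
-- avoids C, so every cover has more than k vertices.

open import Defs
open import Data.Nat using (ℕ; zero; suc; z≤n; s≤s; _≤_; _<_; _∸_; _+_; _*_; _/_; _≤?_)
open import Data.Nat.Properties
  using (≤-trans; ≤-pred; ≰⇒>; m≤m+n; m≤n+m; n≤1+n; +-mono-≤; +-monoʳ-≤; +-cancelʳ-≤; +-comm; *-comm; +-identityʳ; m+[n∸m]≡n)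
open import Data.Nat.DivMod using (m/n*n≤m)
open import Data.Nat.Tactic.RingSolver using (solve-∀)
open import Data.Bool using (_∧_)
open import Data.Fin as Fin using (Fin; quotient; remainder; combine)
open import Data.Fin.Properties using (_≟_; combine-remQuot)
open import Data.Fin.Subset using (Subset; _∈_; _∉_; _∩_; ∣_∣; ⁅_⁆; ⊥; inside; outside)
open import Data.Fin.Subset.Properties
  using (∣⁅x⁆∣≡1; ∣⊥∣≡0; ∩-zeroʳ; ∩-identityʳ; x∈p∩q⁺; x∈p⇒∣p-x∣<∣p∣; drop-there)
open import Data.Vec as Vec using (Vec; []; _∷_; _++_; concat; map; sum; zipWith; tabulate; replicate; group; here; there)
open import Data.Vec.Properties using (zipWith-++; tabulate∘lookup; tabulate-cong; lookup∘tabulate; lookup-replicate; lookup-concat)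
open import Data.List as List using (List; length; filter; cartesianProductWith; allFin)
open import Data.List.Membership.Propositional using () renaming (_∈_ to _∈ᴸ_)
open import Data.List.Membership.Propositional.Properties
  using (∈-cartesianProductWith⁺; ∈-allFin; ∈-lookup; ∈-filter⁺; ∈-filter⁻)
open import Data.List.Relation.Unary.Any as Any using (index)
open import Data.List.Relation.Unary.Any.Properties using (lookup-index)
open import Data.Product using (Σ; ∃; _×_; _,_; proj₁; proj₂)
open import Function using (_∘_)
open import Relation.Nullary using (¬_; yes; no; contradiction)
open import Relation.Nullary.Decidable using (⌊_⌋)
open import Relation.Binary.PropositionalEquality
  using (_≡_; refl; sym; trans; cong; cong₂; subst; module ≡-Reasoning)

private
  variable
    m n q : ℕ

-- A subset of Fin (n * q) is read as n consecutive rows of q vertices;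
-- sizes and intersections are computed row by row.

∣p++p′∣ : (p : Subset m) (p′ : Subset n) → ∣ p ++ p′ ∣ ≡ ∣ p ∣ + ∣ p′ ∣
∣p++p′∣ []            p′ = refl
∣p++p′∣ (inside  ∷ p) p′ = cong suc (∣p++p′∣ p p′)
∣p++p′∣ (outside ∷ p) p′ = ∣p++p′∣ p p′

∣concat∣ : (ps : Vec (Subset q) n) → ∣ concat ps ∣ ≡ sum (map ∣_∣ ps)
∣concat∣ []       = refl
∣concat∣ (p ∷ ps) = trans (∣p++p′∣ p (concat ps)) (cong (∣ p ∣ +_) (∣concat∣ ps))

rowOverlap : Vec (Subset q) n → Vec (Subset q) n → ℕ
rowOverlap ps ps′ = sum (zipWith (λ p p′ → ∣ p ∩ p′ ∣) ps ps′)

∣concat∩concat∣ : (ps ps′ : Vec (Subset q) n) →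
                  ∣ concat ps ∩ concat ps′ ∣ ≡ rowOverlap ps ps′
∣concat∩concat∣ []       []         = refl
∣concat∩concat∣ (p ∷ ps) (p′ ∷ ps′) = begin
  ∣ (p ++ concat ps) ∩ (p′ ++ concat ps′) ∣
    ≡⟨ cong ∣_∣ (zipWith-++ _∧_ p (concat ps) p′ (concat ps′)) ⟩
  ∣ (p ∩ p′) ++ (concat ps ∩ concat ps′) ∣
    ≡⟨ ∣p++p′∣ (p ∩ p′) (concat ps ∩ concat ps′) ⟩
  ∣ p ∩ p′ ∣ + ∣ concat ps ∩ concat ps′ ∣
    ≡⟨ cong (∣ p ∩ p′ ∣ +_) (∣concat∩concat∣ ps ps′) ⟩
  ∣ p ∩ p′ ∣ + rowOverlap ps ps′ ∎
  where open ≡-Reasoning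

∣p∩⊥∣≡0 : (p : Subset n) → ∣ p ∩ ⊥ ∣ ≡ 0
∣p∩⊥∣≡0 {n} p = trans (cong ∣_∣ (∩-zeroʳ p)) (∣⊥∣≡0 n)

rowOverlap-⊥ : (ps : Vec (Subset q) n) → rowOverlap ps (tabulate λ _ → ⊥) ≡ 0
rowOverlap-⊥ []       = refl
rowOverlap-⊥ (p ∷ ps) =
  cong₂ _+_ (∣p∩⊥∣≡0 p) (rowOverlap-⊥ ps)

row : Fin n → Vec (Subset q) n
row {q = q} j = tabulate (λ i → replicate q ⌊ i ≟ j ⌋)

row-suc : (j : Fin n) → row {q = q} (Fin.suc j) ≡ ⊥ ∷ row j
row-suc {q = q} j = cong (⊥ ∷_) (tabulate-cong λ i → cong (replicate q) (⌊suc≟suc⌋ i j))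
  where
  ⌊suc≟suc⌋ : ∀ {n} (i j : Fin n) → ⌊ Fin.suc i ≟ Fin.suc j ⌋ ≡ ⌊ i ≟ j ⌋
  ⌊suc≟suc⌋ i j with i ≟ j
  ... | yes _ = refl
  ... | no  _ = refl

part-quotient : (j : Fin n) → part (quotient {n} q) j ≡ concat (row {q = q} j)
part-quotient {n} {q} j =
  trans (tabulate-cong lookup-row) (tabulate∘lookup (concat (row j)))
  where
  open ≡-Reasoning
  lookup-row : ∀ v → ⌊ quotient {n} q v ≟ j ⌋ ≡ Vec.lookup (concat (row j)) v
  lookup-row v = sym (begin
    Vec.lookup (concat (row j)) v
      ≡⟨ cong (Vec.lookup (concat (row j))) (sym (combine-remQuot {n} q v)) ⟩
    Vec.lookup (concat (row j)) (combine i a)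
      ≡⟨ lookup-concat (row j) i a ⟩
    Vec.lookup (Vec.lookup (row j) i) a
      ≡⟨ cong (λ p → Vec.lookup p a) (lookup∘tabulate _ i) ⟩
    Vec.lookup (replicate q ⌊ i ≟ j ⌋) a
      ≡⟨ lookup-replicate a _ ⟩
    ⌊ i ≟ j ⌋ ∎)
    where
    i = quotient {n} q v
    a = remainder {n} q v

Word : ℕ → ℕ → Set
Word q n = Vec (Fin q) n

trace : Word q n → Subset (n * q)
trace x = concat (map ⁅_⁆ x)

∣trace∣ : (x : Word q n) → ∣ trace x ∣ ≡ n
∣trace∣ x = trans (∣concat∣ (map ⁅_⁆ x)) (count x)
  where
  count : ∀ {n} (x : Word q n) → sum (map ∣_∣ (map ⁅_⁆ x)) ≡ n
  count []      = refl
  count (a ∷ x) = cong₂ _+_ (∣⁅x⁆∣≡1 a) (count x)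

∣trace∩row∣ : (x : Word q n) (j : Fin n) → rowOverlap (map ⁅_⁆ x) (row j) ≡ 1
∣trace∩row∣ (a ∷ x) Fin.zero    =
  cong₂ _+_ (trans (cong ∣_∣ (∩-identityʳ ⁅ a ⁆)) (∣⁅x⁆∣≡1 a)) (rowOverlap-⊥ (map ⁅_⁆ x))
∣trace∩row∣ (a ∷ x) (Fin.suc j) = begin
  rowOverlap (⁅ a ⁆ ∷ map ⁅_⁆ x) (row (Fin.suc j))
    ≡⟨ cong (rowOverlap (⁅ a ⁆ ∷ map ⁅_⁆ x)) (row-suc j) ⟩
  ∣ ⁅ a ⁆ ∩ ⊥ ∣ + rowOverlap (map ⁅_⁆ x) (row j)
    ≡⟨ cong₂ _+_ (∣p∩⊥∣≡0 ⁅ a ⁆) (∣trace∩row∣ x j) ⟩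
  1 ∎
  where open ≡-Reasoning

∣trace∩part∣ : (x : Word q n) (j : Fin n) → ∣ trace x ∩ part (quotient {n} q) j ∣ ≡ 1
∣trace∩part∣ {q} {n} x j = begin
  ∣ trace x ∩ part (quotient {n} q) j ∣ ≡⟨ cong (λ p → ∣ trace x ∩ p ∣) (part-quotient j) ⟩
  ∣ trace x ∩ concat (row j) ∣          ≡⟨ ∣concat∩concat∣ (map ⁅_⁆ x) (row j) ⟩
  rowOverlap (map ⁅_⁆ x) (row j)        ≡⟨ ∣trace∩row∣ x j ⟩
  1                                     ∎
  where open ≡-Reasoning

nonBlank : Fin (suc m) → ℕ
nonBlank Fin.zero    = 0
nonBlank (Fin.suc _) = 1

weight : Word (suc m) n → ℕ
weight []      = 0
weight (a ∷ x) = nonBlank a + weight x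

letter-agree : (a b : Fin (suc m)) → 1 ≤ ∣ ⁅ a ⁆ ∩ ⁅ b ⁆ ∣ + (nonBlank a + nonBlank b)
letter-agree Fin.zero    Fin.zero    = s≤s z≤n
letter-agree Fin.zero    (Fin.suc b) = m≤n+m 1 _
letter-agree (Fin.suc a) b           = ≤-trans (s≤s z≤n) (m≤n+m (suc (nonBlank b)) _)

trace-agree : (x y : Word (suc m) n) → n ≤ ∣ trace x ∩ trace y ∣ + (weight x + weight y)
trace-agree {n = n} x y =
  subst (λ c → n ≤ c + (weight x + weight y))
        (sym (∣concat∩concat∣ (map ⁅_⁆ x) (map ⁅_⁆ y))) (agree x y)
  where
  rearrange : ∀ c i j C a b → (c + (i + j)) + (C + (a + b)) ≡ (c + C) + ((i + a) + (j + b))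
  rearrange = solve-∀
  agree : ∀ {n} (x y : Word (suc m) n) →
          n ≤ rowOverlap (map ⁅_⁆ x) (map ⁅_⁆ y) + (weight x + weight y)
  agree []      []      = z≤n
  agree {n = suc n} (a ∷ x) (b ∷ y) =
    subst (suc n ≤_) (rearrange ∣ ⁅ a ⁆ ∩ ⁅ b ⁆ ∣ (nonBlank a) (nonBlank b)
                            (rowOverlap (map ⁅_⁆ x) (map ⁅_⁆ y)) (weight x) (weight y))
          (+-mono-≤ (letter-agree a b) (agree x y))

∃∉ : (b : Subset n) → ∣ b ∣ < n → ∃ λ a → a ∉ b
∃∉ (outside ∷ b) _       = Fin.zero , λ ()
∃∉ (inside  ∷ b) (s≤s h) = Fin.suc (proj₁ (∃∉ b h)) , proj₂ (∃∉ b h) ∘ drop-there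

∣b∩⁅a⁆∣≡0 : (b : Subset n) (a : Fin n) → a ∉ b → ∣ b ∩ ⁅ a ⁆ ∣ ≡ 0
∣b∩⁅a⁆∣≡0 (outside ∷ b) Fin.zero    _   = ∣p∩⊥∣≡0 b
∣b∩⁅a⁆∣≡0 (inside  ∷ b) Fin.zero    a∉b = contradiction here a∉b
∣b∩⁅a⁆∣≡0 (outside ∷ b) (Fin.suc a) a∉b = ∣b∩⁅a⁆∣≡0 b a (a∉b ∘ there)
∣b∩⁅a⁆∣≡0 (inside  ∷ b) (Fin.suc a) a∉b = ∣b∩⁅a⁆∣≡0 b a (a∉b ∘ there)

-- A row with at most m of the m+1 letters marked has an unmarked letter,
-- and it can be chosen blank unless the blank letter is marked.
unmarkedLetter : (b : Subset (suc m)) → ∣ b ∣ ≤ m →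
                 Σ (Fin (suc m)) λ a → a ∉ b × nonBlank a ≤ ∣ b ∣
unmarkedLetter (outside ∷ b) _ = Fin.zero , (λ ()) , z≤n
unmarkedLetter (inside  ∷ b) h =
  Fin.suc (proj₁ (∃∉ b h)) , proj₂ (∃∉ b h) ∘ drop-there , s≤s z≤n

avoidingWord : (cs : Vec (Subset (suc m)) n) → sum (map ∣_∣ cs) ≤ m →
               Σ (Word (suc m) n) λ x →
                 weight x ≤ sum (map ∣_∣ cs) × rowOverlap cs (map ⁅_⁆ x) ≡ 0
avoidingWord []       _ = [] , z≤n , refl
avoidingWord (c ∷ cs) h
  with unmarkedLetter c (≤-trans (m≤m+n _ _) h) | avoidingWord cs (≤-trans (m≤n+m _ _) h)
... | a , a∉c , a≤ | x , x≤ , x∩cs = a ∷ x , +-mono-≤ a≤ x≤ , cong₂ _+_ (∣b∩⁅a⁆∣≡0 c a a∉c) x∩cs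

avoidingTrace : (C : Subset (n * suc m)) → ∣ C ∣ ≤ m →
                Σ (Word (suc m) n) λ x → weight x ≤ ∣ C ∣ × ∣ C ∩ trace x ∣ ≡ 0
avoidingTrace {n} {m} C ∣C∣≤m
  with group n (suc m) C
... | cs , refl with avoidingWord cs (subst (_≤ m) (∣concat∣ cs) ∣C∣≤m)
... | x , x≤ , x∩cs =
  x , subst (weight x ≤_) (sym (∣concat∣ cs)) x≤ ,
  trans (∣concat∩concat∣ cs (map ⁅_⁆ x)) x∩cs

∈⇒1≤∣p∣ : {p : Subset n} {v : Fin n} → v ∈ p → 1 ≤ ∣ p ∣
∈⇒1≤∣p∣ v∈p = ≤-trans (s≤s z≤n) (x∈p⇒∣p-x∣<∣p∣ v∈p)

traceHypergraph : List (Word q n) → Hypergraph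
traceHypergraph {q} {n} ws = record
  { nV = n * q ; nE = length ws ; edge = λ i → trace (List.lookup ws i) }

traceHypergraph-uniform : (ws : List (Word q n)) → IsUniform n (traceHypergraph ws)
traceHypergraph-uniform ws i = ∣trace∣ (List.lookup ws i)

traceHypergraph-partite : (ws : List (Word q n)) → IsPartite n (traceHypergraph ws)
traceHypergraph-partite {q} {n} ws =
  quotient {n} q , λ i j → ∣trace∩part∣ (List.lookup ws i) j

traceHypergraph-intersecting : ∀ {t k} (ws : List (Word (suc m) n)) →
  t + (k + k) ≤ n → (∀ {x} → x ∈ᴸ ws → weight x ≤ k) →
  IsIntersecting t (traceHypergraph ws)
traceHypergraph-intersecting {t = t} {k} ws t+2k≤n light i j =
  +-cancelʳ-≤ (k + k) t _ (≤-trans t+2k≤n (≤-trans (trace-agree x y)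
    (+-monoʳ-≤ ∣ trace x ∩ trace y ∣ (+-mono-≤ (light (∈-lookup i)) (light (∈-lookup j))))))
  where
  x = List.lookup ws i
  y = List.lookup ws j

traceHypergraph-smallNotCover : ∀ {k} (ws : List (Word (suc m) n)) → k ≤ m →
  (∀ x → weight x ≤ k → x ∈ᴸ ws) →
  (C : Subset (n * suc m)) → ∣ C ∣ ≤ k → ¬ IsCover (traceHypergraph ws) C
traceHypergraph-smallNotCover ws k≤m complete C ∣C∣≤k cover
  with avoidingTrace C (≤-trans ∣C∣≤k k≤m)
... | x , x≤∣C∣ , ∣C∩x∣≡0 with complete x (≤-trans x≤∣C∣ ∣C∣≤k)
... | x∈ws with cover (index x∈ws)
... | v , v∈C , v∈edge =
  contradiction (subst (1 ≤_) ∣C∩x∣≡0 (∈⇒1≤∣p∣ (x∈p∩q⁺ (v∈C , v∈x)))) λ ()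
  where
  v∈x : v ∈ trace x
  v∈x = subst (λ y → v ∈ trace y) (sym (lookup-index x∈ws)) v∈edge

traceHypergraph-cover : ∀ {k} (ws : List (Word (suc m) n)) → k ≤ m →
  (∀ x → weight x ≤ k → x ∈ᴸ ws) →
  CoverNumberAtLeast (traceHypergraph ws) (suc k)
traceHypergraph-cover {k = k} ws k≤m complete C cover with suc k ≤? ∣ C ∣
... | yes k<∣C∣ = k<∣C∣
... | no  k≮∣C∣ =
  contradiction cover (traceHypergraph-smallNotCover ws k≤m complete C (≤-pred (≰⇒> k≮∣C∣)))

allWords : ∀ q n → List (Word q n)
allWords q zero    = List.[ [] ]
allWords q (suc n) = cartesianProductWith _∷_ (allFin q) (allWords q n)

∈-allWords : (x : Word q n) → x ∈ᴸ allWords q n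
∈-allWords []      = Any.here refl
∈-allWords (a ∷ x) = ∈-cartesianProductWith⁺ _∷_ (∈-allFin a) (∈-allWords x)

lightWords : ∀ m n k → List (Word (suc m) n)
lightWords m n k = filter (λ x → weight x ≤? k) (allWords (suc m) n)

lightWords-light : ∀ k {x : Word (suc m) n} → x ∈ᴸ lightWords m n k → weight x ≤ k
lightWords-light {m} {n} k x∈ws =
  proj₂ (∈-filter⁻ (λ x → weight x ≤? k) {xs = allWords (suc m) n} x∈ws)

lightWords-complete : ∀ k (x : Word (suc m) n) → weight x ≤ k → x ∈ᴸ lightWords m n k
lightWords-complete k x = ∈-filter⁺ (λ x → weight x ≤? k) (∈-allWords x)

t+2⌊r∸t/2⌋≤r : ∀ {r t} → t ≤ r → t + ((r ∸ t) / 2 + (r ∸ t) / 2) ≤ r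
t+2⌊r∸t/2⌋≤r {r} {t} t≤r =
  subst (t + (k + k) ≤_) (m+[n∸m]≡n t≤r) (+-monoʳ-≤ t k+k≤r∸t)
  where
  k = (r ∸ t) / 2
  k+k≤r∸t : k + k ≤ r ∸ t
  k+k≤r∸t = subst (_≤ r ∸ t) (trans (*-comm k 2) (cong (k +_) (+-identityʳ k)))
                  (m/n*n≤m (r ∸ t) 2)

theorem1p3 : ∀ (r t : ℕ) → 1 ≤ t → t ≤ r → RAtLeast r t ((r ∸ t) / 2 + 1)
theorem1p3 r t _ t≤r =
  subst (RAtLeast r t) (+-comm 1 k)
    ( traceHypergraph ws
    , ( traceHypergraph-uniform ws
      , traceHypergraph-partite ws
      , traceHypergraph-intersecting ws (t+2⌊r∸t/2⌋≤r t≤r) (lightWords-light k) )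
    , traceHypergraph-cover ws (n≤1+n k) (lightWords-complete k) )
  where
  k  = (r ∸ t) / 2
  ws = lightWords (suc k) r k
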